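{- Let $s$ be a string and $c$ a character, and let $P$ range over non-empty palindromes. Then: (push_back) $\mathit{cnt}(sc,P)=\mathit{cnt}(s,P)+1$ if $P=\mathit{sufpal}(sc,|sc|)$, and $\mathit{cnt}(sc,P)=\mathit{cnt}(s,P)$ otherwise; (push_front) $\mathit{cnt}(cs,P)=\mathit{cnt}(s,P)+1$ if $P=\mathit{prepal}(cs,1)$, and $\mathit{cnt}(cs,P)=\mathit{cnt}(s,P)$ otherwise; (pop_back) if $s$ is non-empty, $\mathit{cnt}(s[1..|s|-1],P)=\mathit{cnt}(s,P)-1$ if $P=\mathit{sufpal}(s,|s|)$, and $\mathit{cnt}(s[1..|s|-1],P)=\mathit{cnt}(s,P)$ otherwise; (pop_front) if $s$ is non-empty, $\mathit{cnt}(s[2..|s|],P)=\mathit{cnt}(s,P)-1$ if $P=\mathit{prepal}(s,1)$, and $\mathit{cnt}(s[2..|s|],P)=\mathit{cnt}(s,P)$ otherwise.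
   Context: $s[i..j]=s[i]\cdots s[j]$ (empty if $i>j$); a palindrome is a string equal to its reverse. For $1\le i\le|s|$, $\mathit{sufpal}(s,i)$ is the longest palindromic suffix of $s[1..i]$ and $\mathit{prepal}(s,i)$ is the longest palindromic prefix of $s[i..|s|]$. For a non-empty palindrome $P$, $\mathit{cnt}(s,P)=|\{1\le i\le|s|:\mathit{sufpal}(s,i)=P\}|$; this number always equals $|\{1\le i\le|s|:\mathit{prepal}(s,i)=P\}|$. -}

module Defs where

open import Data.Nat using (ℕ; zero; suc; _∸_)
open import Data.List using (List; []; _∷_; reverse; take; drop; length; upTo; filter; map)
open import Data.List.Properties using (≡-dec)
open import Relation.Binary.Definitions using (DecidableEquality)
open import Relation.Binary.PropositionalEquality using (_≡_)
open import Relation.Nullary using (Dec; yes; no)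

module _ {A : Set} (_≟_ : DecidableEquality A) where

  _≟ₗ_ : DecidableEquality (List A)
  _≟ₗ_ = ≡-dec _≟_

  IsPalindrome : List A → Set
  IsPalindrome t = t ≡ reverse t

  isPalindrome? : (t : List A) → Dec (IsPalindrome t)
  isPalindrome? t = t ≟ₗ reverse t

  longestPalSuffix : List A → List A
  longestPalSuffix [] = []
  longestPalSuffix (x ∷ xs) with isPalindrome? (x ∷ xs)
  ... | yes _ = x ∷ xs
  ... | no  _ = longestPalSuffix xs

  longestPalPrefixAux : List A → ℕ → List A
  longestPalPrefixAux t zero = []
  longestPalPrefixAux t (suc n) with isPalindrome? (take (suc n) t)
  ... | yes _ = take (suc n) t
  ... | no  _ = longestPalPrefixAux t n

  longestPalPrefix : List A → List A
  longestPalPrefix t = longestPalPrefixAux t (length t)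

  -- sufpal(s,i) = longest palindromic suffix of s[1..i]   (1-based i)
  sufpal : List A → ℕ → List A
  sufpal s i = longestPalSuffix (take i s)

  -- prepal(s,i) = longest palindromic prefix of s[i..|s|]  (1-based i)
  prepal : List A → ℕ → List A
  prepal s i = longestPalPrefix (drop (i ∸ 1) s)

  indices : ℕ → List ℕ
  indices n = map suc (upTo n)

  cnt : List A → List A → ℕ
  cnt s P = length (filter (λ i → sufpal s i ≟ₗ P) (indices (length s)))

-- cnt(s,P) counts the non-empty prefixes of s whose longest palindromic suffix
-- is P, so appending a character adds exactly one counted prefix; this gives
-- push_back and pop_back. For push_front, let s grow on the right and compare the
-- prefixes c t of cs with the prefixes t of s: the invariant is that the former
-- count exceeds the latter by [P = prepal(cs,1)]. When s becomes sx and csx is a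
-- palindrome, csx is its own longest palindromic suffix and prefix, while sx is
-- the mirror image of cs, so its longest palindromic suffix is the old
-- prepal(cs,1). Otherwise csx has the same longest palindromic suffix as sx and
-- the same longest palindromic prefix as cs. pop_front is push_front read
-- backwards.
module Submission where

open import Defs
open import Algebra.Properties.CommutativeSemigroup using (xy∙z≈xz∙y)
open import Data.Empty using (⊥-elim)
open import Data.List using (List; []; _∷_; _∷ʳ_; _++_; _ʳ++_; [_]; length; take; drop; reverse; map; filter; upTo; applyUpTo; inits; module Inits)
open import Data.List.Properties using (∷-injectiveʳ; length-++; length-reverse; reverse-++; reverse-involutive; ʳ++-defn; map-++; map-∘; map-applyUpTo; filter-++; filter-accept; filter-reject; take-all)
open import Data.List.Reverse using (Reverse; []; _∶_∶ʳ_; reverseView)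
open import Data.Nat using (ℕ; suc; _+_; _∸_)
open import Data.Nat.Properties using (+-commutativeSemigroup; +-identityʳ; m+n∸n≡m; ≤-refl)
open import Data.Product using (_×_; _,_)
open import Function using (_∘_)
open import Relation.Binary.Definitions using (DecidableEquality)
open import Relation.Binary.PropositionalEquality using (_≡_; _≢_; refl; sym; trans; cong; cong₂; subst; module ≡-Reasoning)
open import Relation.Nullary using (¬_; Dec; yes; no)

take-length-++ : {A : Set} (xs ys : List A) → take (length xs) (xs ++ ys) ≡ xs
take-length-++ []       ys = refl
take-length-++ (x ∷ xs) ys = cong (x ∷_) (take-length-++ xs ys)

take-length-ʳ++ : {A : Set} (xs ys : List A) → take (length xs) (xs ʳ++ ys) ≡ reverse xs
take-length-ʳ++ xs ys = trans (cong₂ take (sym (length-reverse xs)) (ʳ++-defn xs)) (take-length-++ (reverse xs) ys)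

take-pred-length-∷ʳ : {A : Set} (xs : List A) (x : A) → take (length (xs ∷ʳ x) ∸ 1) (xs ∷ʳ x) ≡ xs
take-pred-length-∷ʳ xs x = begin
  take (length (xs ∷ʳ x) ∸ 1) (xs ∷ʳ x) ≡⟨ cong (λ n → take (n ∸ 1) (xs ∷ʳ x)) (length-++ xs) ⟩
  take (length xs + 1 ∸ 1) (xs ∷ʳ x)    ≡⟨ cong (λ n → take n (xs ∷ʳ x)) (m+n∸n≡m (length xs) 1) ⟩
  take (length xs) (xs ∷ʳ x)            ≡⟨ take-length-++ xs [ x ] ⟩
  xs                                    ∎
  where open ≡-Reasoning

Inits-tail-∷ʳ : {A : Set} (xs : List A) (x : A) → Inits.tail (xs ∷ʳ x) ≡ Inits.tail xs ∷ʳ (xs ∷ʳ x)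
Inits-tail-∷ʳ []       x = refl
Inits-tail-∷ʳ (y ∷ ys) x =
  cong ([ y ] ∷_) (trans (cong (map (y ∷_)) (Inits-tail-∷ʳ ys x)) (map-++ (y ∷_) (Inits.tail ys) _))

applyUpTo-take-suc : {A : Set} (xs : List A) → applyUpTo (λ i → take (suc i) xs) (length xs) ≡ Inits.tail xs
applyUpTo-take-suc []       = refl
applyUpTo-take-suc (x ∷ xs) = cong ([ x ] ∷_) (begin
  applyUpTo ((x ∷_) ∘ λ i → take (suc i) xs) (length xs)  ≡⟨ map-applyUpTo _ (x ∷_) (length xs) ⟨
  map (x ∷_) (applyUpTo (λ i → take (suc i) xs) (length xs)) ≡⟨ cong (map (x ∷_)) (applyUpTo-take-suc xs) ⟩
  map (x ∷_) (Inits.tail xs)                                   ∎)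
  where open ≡-Reasoning

module _ {A : Set} (_≟_ : DecidableEquality A) where

  private
    Pal : List A → Set
    Pal = IsPalindrome _≟_

    lps : List A → List A
    lps = longestPalSuffix _≟_

    lpp : List A → List A
    lpp = longestPalPrefix _≟_

    lppAux : List A → ℕ → List A
    lppAux = longestPalPrefixAux _≟_

  reverse-isPalindrome : ∀ {t} → Pal t → Pal (reverse t)
  reverse-isPalindrome {t} p = trans (sym p) (sym (reverse-involutive t))

  reverse-isPalindrome⁻¹ : ∀ {t} → Pal (reverse t) → Pal t
  reverse-isPalindrome⁻¹ {t} p = subst Pal (reverse-involutive t) (reverse-isPalindrome p)

  longestPalSuffix-accept : ∀ {x xs} → Pal (x ∷ xs) → lps (x ∷ xs) ≡ x ∷ xs
  longestPalSuffix-accept {x} {xs} p with isPalindrome? _≟_ (x ∷ xs)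
  ... | yes _ = refl
  ... | no ¬p = ⊥-elim (¬p p)

  longestPalSuffix-reject : ∀ {x xs} → ¬ Pal (x ∷ xs) → lps (x ∷ xs) ≡ lps xs
  longestPalSuffix-reject {x} {xs} ¬p with isPalindrome? _≟_ (x ∷ xs)
  ... | yes p = ⊥-elim (¬p p)
  ... | no _  = refl

  longestPalSuffix-isPalindrome : ∀ t → Pal (lps t)
  longestPalSuffix-isPalindrome []       = refl
  longestPalSuffix-isPalindrome (x ∷ xs) with isPalindrome? _≟_ (x ∷ xs)
  ... | yes p = p
  ... | no _  = longestPalSuffix-isPalindrome xs

  longestPalSuffix-palindrome : ∀ {t} → Pal t → lps t ≡ t
  longestPalSuffix-palindrome {[]}    _ = refl
  longestPalSuffix-palindrome {_ ∷ _} p = longestPalSuffix-accept p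

  longestPalPrefixAux-accept : ∀ t n → Pal (take (suc n) t) → lppAux t (suc n) ≡ take (suc n) t
  longestPalPrefixAux-accept t n p with isPalindrome? _≟_ (take (suc n) t)
  ... | yes _ = refl
  ... | no ¬p = ⊥-elim (¬p p)

  longestPalPrefixAux-reject : ∀ t n → ¬ Pal (take (suc n) t) → lppAux t (suc n) ≡ lppAux t n
  longestPalPrefixAux-reject t n ¬p with isPalindrome? _≟_ (take (suc n) t)
  ... | yes p = ⊥-elim (¬p p)
  ... | no _  = refl

  -- The prefixes of r ʳ++ w of length ≤ |r| are the reverses of the suffixes
  -- of r, tried in the same (longest first) order.
  longestPalPrefixAux-ʳ++ : ∀ r w → lppAux (r ʳ++ w) (length r) ≡ reverse (lps r)
  longestPalPrefixAux-ʳ++ []       w = refl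
  longestPalPrefixAux-ʳ++ (y ∷ ys) w with isPalindrome? _≟_ (y ∷ ys) | take-length-ʳ++ (y ∷ ys) w
  ... | yes p  | prefix =
    trans (longestPalPrefixAux-accept (ys ʳ++ y ∷ w) (length ys) (subst Pal (sym prefix) (reverse-isPalindrome p))) prefix
  ... | no ¬p | prefix =
    trans (longestPalPrefixAux-reject (ys ʳ++ y ∷ w) (length ys) (¬p ∘ reverse-isPalindrome⁻¹ ∘ subst Pal prefix))
          (longestPalPrefixAux-ʳ++ ys (y ∷ w))

  longestPalPrefix-reverse : ∀ u → lpp u ≡ reverse (lps (reverse u))
  longestPalPrefix-reverse u = begin
    lppAux u (length u)                            ≡⟨ cong₂ lppAux (sym (reverse-involutive u)) (sym (length-reverse u)) ⟩
    lppAux (reverse u ʳ++ []) (length (reverse u)) ≡⟨ longestPalPrefixAux-ʳ++ (reverse u) [] ⟩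
    reverse (lps (reverse u))                      ∎
    where open ≡-Reasoning

  longestPalPrefix-palindrome : ∀ {u} → Pal u → lpp u ≡ u
  longestPalPrefix-palindrome {u} p = begin
    lpp u                     ≡⟨ longestPalPrefix-reverse u ⟩
    reverse (lps (reverse u)) ≡⟨ cong reverse (longestPalSuffix-palindrome (reverse-isPalindrome p)) ⟩
    reverse (reverse u)       ≡⟨ reverse-involutive u ⟩
    u                         ∎
    where open ≡-Reasoning

  longestPalPrefix-∷ʳ-reject : ∀ {u x} → ¬ Pal (u ∷ʳ x) → lpp (u ∷ʳ x) ≡ lpp u
  longestPalPrefix-∷ʳ-reject {u} {x} ¬p = begin
    lpp (u ∷ʳ x)                     ≡⟨ longestPalPrefix-reverse (u ∷ʳ x) ⟩
    reverse (lps (reverse (u ∷ʳ x))) ≡⟨ cong (reverse ∘ lps) reverse-∷ʳ ⟩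
    reverse (lps (x ∷ reverse u))    ≡⟨ cong reverse (longestPalSuffix-reject (¬p ∘ reverse-isPalindrome⁻¹ ∘ subst Pal (sym reverse-∷ʳ))) ⟩
    reverse (lps (reverse u))        ≡⟨ longestPalPrefix-reverse u ⟨
    lpp u                            ∎
    where
    open ≡-Reasoning
    reverse-∷ʳ : reverse (u ∷ʳ x) ≡ x ∷ reverse u
    reverse-∷ʳ = reverse-++ u [ x ]

  -- In a palindrome c s x, the suffix s x is the mirror image of the prefix c s.
  longestPalSuffix-mirror : ∀ {c s x} → Pal (c ∷ s ∷ʳ x) → lps (s ∷ʳ x) ≡ lpp (c ∷ s)
  longestPalSuffix-mirror {c} {s} {x} p = begin
    lps (s ∷ʳ x)                        ≡⟨ cong lps (∷-injectiveʳ (trans p (reverse-++ (c ∷ s) [ x ]))) ⟩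
    lps (reverse (c ∷ s))               ≡⟨ longestPalSuffix-isPalindrome (reverse (c ∷ s)) ⟩
    reverse (lps (reverse (c ∷ s)))     ≡⟨ longestPalPrefix-reverse (c ∷ s) ⟨
    lpp (c ∷ s)                         ∎
    where open ≡-Reasoning

  sufpal-length : ∀ s → sufpal _≟_ s (length s) ≡ lps s
  sufpal-length s = cong lps (take-all (length s) s ≤-refl)

  module Occurrences (P : List A) where

    occurrences : List (List A) → ℕ
    occurrences ts = length (filter (λ t → _≟ₗ_ _≟_ t P) ts)

    occurrences-++ : ∀ ts us → occurrences (ts ++ us) ≡ occurrences ts + occurrences us
    occurrences-++ ts us = trans (cong length (filter-++ (λ t → _≟ₗ_ _≟_ t P) ts us)) (length-++ (filter _ ts))

    occurrences-map-∷ʳ : ∀ {B : Set} (f : B → List A) ts t → occurrences (map f (ts ∷ʳ t)) ≡ occurrences (map f ts) + occurrences [ f t ]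
    occurrences-map-∷ʳ f ts t = trans (cong occurrences (map-++ f ts [ t ])) (occurrences-++ (map f ts) [ f t ])

    occurrences-singleton-≡ : ∀ {t} → P ≡ t → occurrences [ t ] ≡ 1
    occurrences-singleton-≡ e = cong length (filter-accept (λ t → _≟ₗ_ _≟_ t P) (sym e))

    occurrences-singleton-≢ : ∀ {t} → P ≢ t → occurrences [ t ] ≡ 0
    occurrences-singleton-≢ e = cong length (filter-reject (λ t → _≟ₗ_ _≟_ t P) (e ∘ sym))

    occurrences-map : ∀ {B : Set} (f : B → List A) xs → occurrences (map f xs) ≡ length (filter (λ x → _≟ₗ_ _≟_ (f x) P) xs)
    occurrences-map f []       = refl
    occurrences-map f (x ∷ xs) with _≟ₗ_ _≟_ (f x) P
    ... | yes _ = cong suc (occurrences-map f xs)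
    ... | no _  = occurrences-map f xs

    cnt-Inits : ∀ s → cnt _≟_ s P ≡ occurrences (map lps (Inits.tail s))
    cnt-Inits s = begin
      cnt _≟_ s P                                          ≡⟨ occurrences-map (sufpal _≟_ s) (indices _≟_ (length s)) ⟨
      occurrences (map (sufpal _≟_ s) (map suc (upTo n)))  ≡⟨ cong occurrences (map-∘ (upTo n)) ⟨
      occurrences (map (sufpal _≟_ s ∘ suc) (upTo n))      ≡⟨ cong occurrences (map-applyUpTo (λ i → i) (sufpal _≟_ s ∘ suc) n) ⟩
      occurrences (applyUpTo (sufpal _≟_ s ∘ suc) n)       ≡⟨ cong occurrences (map-applyUpTo (λ i → take (suc i) s) lps n) ⟨
      occurrences (map lps (applyUpTo (λ i → take (suc i) s) n)) ≡⟨ cong (occurrences ∘ map lps) (applyUpTo-take-suc s) ⟩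
      occurrences (map lps (Inits.tail s))                 ∎
      where
      open ≡-Reasoning
      n : ℕ
      n = length s

    cnt-∷ʳ : ∀ s x → cnt _≟_ (s ∷ʳ x) P ≡ cnt _≟_ s P + occurrences [ sufpal _≟_ (s ∷ʳ x) (length (s ∷ʳ x)) ]
    cnt-∷ʳ s x = begin
      cnt _≟_ (s ∷ʳ x) P                                                  ≡⟨ cnt-Inits (s ∷ʳ x) ⟩
      occurrences (map lps (Inits.tail (s ∷ʳ x)))                          ≡⟨ cong (occurrences ∘ map lps) (Inits-tail-∷ʳ s x) ⟩
      occurrences (map lps (Inits.tail s ∷ʳ (s ∷ʳ x)))                     ≡⟨ occurrences-map-∷ʳ lps (Inits.tail s) (s ∷ʳ x) ⟩
      occurrences (map lps (Inits.tail s)) + occurrences [ lps (s ∷ʳ x) ]  ≡⟨ cong₂ _+_ (cnt-Inits s) (cong (occurrences ∘ [_]) (sufpal-length (s ∷ʳ x))) ⟨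
      cnt _≟_ s P + occurrences [ sufpal _≟_ (s ∷ʳ x) (length (s ∷ʳ x)) ]  ∎
      where open ≡-Reasoning

    occurrences-prepend-step : ∀ R c s x →
      R + occurrences [ lpp (c ∷ s) ] + occurrences [ lps (c ∷ s ∷ʳ x) ]
        ≡ R + occurrences [ lps (s ∷ʳ x) ] + occurrences [ lpp (c ∷ s ∷ʳ x) ]
    occurrences-prepend-step R c s x = by-cases (isPalindrome? _≟_ (c ∷ s ∷ʳ x))
      where
      open ≡-Reasoning
      by-cases : Dec (Pal (c ∷ s ∷ʳ x)) →
        R + occurrences [ lpp (c ∷ s) ] + occurrences [ lps (c ∷ s ∷ʳ x) ]
          ≡ R + occurrences [ lps (s ∷ʳ x) ] + occurrences [ lpp (c ∷ s ∷ʳ x) ]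
      by-cases (yes p) = cong₂ (λ u v → R + occurrences [ u ] + occurrences [ v ])
                               (sym (longestPalSuffix-mirror p))
                               (trans (longestPalSuffix-accept p) (sym (longestPalPrefix-palindrome p)))
      by-cases (no ¬p) = begin
        R + occurrences [ lpp (c ∷ s) ] + occurrences [ lps (c ∷ s ∷ʳ x) ] ≡⟨ cong (λ u → R + _ + occurrences [ u ]) (longestPalSuffix-reject ¬p) ⟩
        R + occurrences [ lpp (c ∷ s) ] + occurrences [ lps (s ∷ʳ x) ]     ≡⟨ xy∙z≈xz∙y +-commutativeSemigroup R _ _ ⟩
        R + occurrences [ lps (s ∷ʳ x) ] + occurrences [ lpp (c ∷ s) ]     ≡⟨ cong (λ u → R + _ + occurrences [ u ]) (longestPalPrefix-∷ʳ-reject {c ∷ s} {x} ¬p) ⟨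
        R + occurrences [ lps (s ∷ʳ x) ] + occurrences [ lpp (c ∷ s ∷ʳ x) ] ∎

    occurrences-prepend : ∀ c {s} → Reverse s →
      occurrences (map (lps ∘ (c ∷_)) (inits s)) ≡ occurrences (map lps (Inits.tail s)) + occurrences [ lpp (c ∷ s) ]
    occurrences-prepend c [] =
      cong (occurrences ∘ [_]) (trans (longestPalSuffix-palindrome {c ∷ []} refl) (sym (longestPalPrefix-palindrome {c ∷ []} refl)))
    occurrences-prepend c (s ∶ rs ∶ʳ x) = begin
      occurrences (map (lps ∘ (c ∷_)) (inits (s ∷ʳ x)))                     ≡⟨ cong (occurrences ∘ map (lps ∘ (c ∷_)) ∘ ([] ∷_)) (Inits-tail-∷ʳ s x) ⟩
      occurrences (map (lps ∘ (c ∷_)) (inits s ∷ʳ (s ∷ʳ x)))                ≡⟨ occurrences-map-∷ʳ (lps ∘ (c ∷_)) (inits s) (s ∷ʳ x) ⟩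
      occurrences (map (lps ∘ (c ∷_)) (inits s)) + occurrences [ lps (c ∷ s ∷ʳ x) ]
        ≡⟨ cong (_+ occurrences [ lps (c ∷ s ∷ʳ x) ]) (occurrences-prepend c rs) ⟩
      R + occurrences [ lpp (c ∷ s) ] + occurrences [ lps (c ∷ s ∷ʳ x) ]    ≡⟨ occurrences-prepend-step R c s x ⟩
      R + occurrences [ lps (s ∷ʳ x) ] + occurrences [ lpp (c ∷ s ∷ʳ x) ]   ≡⟨ cong (_+ occurrences [ lpp (c ∷ s ∷ʳ x) ]) (occurrences-map-∷ʳ lps (Inits.tail s) (s ∷ʳ x)) ⟨
      occurrences (map lps (Inits.tail s ∷ʳ (s ∷ʳ x))) + occurrences [ lpp (c ∷ s ∷ʳ x) ]
        ≡⟨ cong (λ ts → occurrences (map lps ts) + occurrences [ lpp (c ∷ s ∷ʳ x) ]) (Inits-tail-∷ʳ s x) ⟨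
      occurrences (map lps (Inits.tail (s ∷ʳ x))) + occurrences [ lpp (c ∷ s ∷ʳ x) ] ∎
      where
      open ≡-Reasoning
      R : ℕ
      R = occurrences (map lps (Inits.tail s))

    cnt-∷ : ∀ c s → cnt _≟_ (c ∷ s) P ≡ cnt _≟_ s P + occurrences [ prepal _≟_ (c ∷ s) 1 ]
    cnt-∷ c s = begin
      cnt _≟_ (c ∷ s) P                                                 ≡⟨ cnt-Inits (c ∷ s) ⟩
      occurrences (lps [ c ] ∷ map lps (map (c ∷_) (Inits.tail s)))     ≡⟨ cong (occurrences ∘ (lps [ c ] ∷_)) (map-∘ (Inits.tail s)) ⟨
      occurrences (map (lps ∘ (c ∷_)) (inits s))                        ≡⟨ occurrences-prepend c (reverseView s) ⟩
      occurrences (map lps (Inits.tail s)) + occurrences [ lpp (c ∷ s) ] ≡⟨ cong (_+ occurrences [ lpp (c ∷ s) ]) (cnt-Inits s) ⟨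
      cnt _≟_ s P + occurrences [ prepal _≟_ (c ∷ s) 1 ]               ∎
      where open ≡-Reasoning

    cnt-init : ∀ s → s ≢ [] → cnt _≟_ s P ≡ cnt _≟_ (take (length s ∸ 1) s) P + occurrences [ sufpal _≟_ s (length s) ]
    cnt-init s s≢[] with reverseView s
    ... | []          = ⊥-elim (s≢[] refl)
    ... | v ∶ _ ∶ʳ y = trans (cnt-∷ʳ v y)
      (cong (λ t → cnt _≟_ t P + occurrences [ sufpal _≟_ (v ∷ʳ y) (length (v ∷ʳ y)) ]) (sym (take-pred-length-∷ʳ v y)))

    cnt-tail : ∀ s → s ≢ [] → cnt _≟_ s P ≡ cnt _≟_ (drop 1 s) P + occurrences [ prepal _≟_ s 1 ]
    cnt-tail []      s≢[] = ⊥-elim (s≢[] refl)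
    cnt-tail (c ∷ s) _    = cnt-∷ c s

    push-cases : ∀ {m n t} → m ≡ n + occurrences [ t ] → (P ≡ t → m ≡ n + 1) × (P ≢ t → m ≡ n)
    push-cases {n = n} m≡ =
        (λ P≡t → trans m≡ (cong (n +_) (occurrences-singleton-≡ P≡t)))
      , (λ P≢t → trans m≡ (trans (cong (n +_) (occurrences-singleton-≢ P≢t)) (+-identityʳ n)))

    pop-cases : ∀ {m n t} → m ≡ n + occurrences [ t ] → (P ≡ t → n ≡ m ∸ 1) × (P ≢ t → n ≡ m)
    pop-cases {n = n} m≡ with push-cases m≡
    ... | m≡n+1 , m≡n = (λ P≡t → sym (trans (cong (_∸ 1) (m≡n+1 P≡t)) (m+n∸n≡m n 1))) , (λ P≢t → sym (m≡n P≢t))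

-- The identities hold for every P: the empty string is never a longest
-- palindromic suffix or prefix of a non-empty string.
lemma20 : {A : Set} (_≟_ : DecidableEquality A) (s : List A) (c : A) (P : List A) →
    IsPalindrome _≟_ P → P ≢ [] →
    ((P ≡ sufpal _≟_ (s ∷ʳ c) (length (s ∷ʳ c)) → cnt _≟_ (s ∷ʳ c) P ≡ cnt _≟_ s P + 1)
      × (P ≢ sufpal _≟_ (s ∷ʳ c) (length (s ∷ʳ c)) → cnt _≟_ (s ∷ʳ c) P ≡ cnt _≟_ s P))
    × ((P ≡ prepal _≟_ (c ∷ s) 1 → cnt _≟_ (c ∷ s) P ≡ cnt _≟_ s P + 1)
      × (P ≢ prepal _≟_ (c ∷ s) 1 → cnt _≟_ (c ∷ s) P ≡ cnt _≟_ s P))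
    × (s ≢ [] →
        (P ≡ sufpal _≟_ s (length s) → cnt _≟_ (take (length s ∸ 1) s) P ≡ cnt _≟_ s P ∸ 1)
        × (P ≢ sufpal _≟_ s (length s) → cnt _≟_ (take (length s ∸ 1) s) P ≡ cnt _≟_ s P))
    × (s ≢ [] →
        (P ≡ prepal _≟_ s 1 → cnt _≟_ (drop 1 s) P ≡ cnt _≟_ s P ∸ 1)
        × (P ≢ prepal _≟_ s 1 → cnt _≟_ (drop 1 s) P ≡ cnt _≟_ s P))
lemma20 _≟_ s c P _ _ =
    push-cases (cnt-∷ʳ s c)
  , push-cases (cnt-∷ c s)
  , pop-cases ∘ cnt-init s
  , pop-cases ∘ cnt-tail s
  where open Occurrences _≟_ P
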